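{- Let $K$ be a subfield of $\mathbb{C}$, $e\ge2$, and let $f,g:\mathbb{Z}/e\mathbb{Z}\to\mathbb{C}$. Suppose there are $A=[a_{i,j}]$, $B=[b_{i,j}]\in M_e(K)$ (indices mod $e$, $A[i,j]=a_{i,j}$) such that for all $i,j\in\mathbb{Z}/e\mathbb{Z}$ \[ f(i)f(j)=\sum_{k=0}^{e-1}a_{j-i,k-i}f(k),\qquad g(i)g(j)=\sum_{k=0}^{e-1}b_{j-i,k-i}g(k). \] Then for every $d\in\mathbb{Z}/e\mathbb{Z}\setminus\{0\}$ and all $i,j$, \[ (f\overset{d}{\ast}g)(i)\,(f\overset{d}{\ast}g)(j)=\sum_{k=0}^{e-1}(A\overset{d}{\ast}B)[j-i,k-i]\,(f\overset{d}{\ast}g)(k). \] In particular, for every $n\ge1$ and all $i,j$, $f^{(n)}(i)f^{(n)}(j)=\sum_{k=0}^{e-1}A^{(n)}[j-i,k-i]\,f^{(n)}(k)$.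
   Context: For $f,g:\mathbb{Z}/e\mathbb{Z}\to\mathbb{C}$ and $d\in\mathbb{Z}/e\mathbb{Z}\setminus\{0\}$, $(f\overset{d}{\ast}g)(i)=\sum_{s=0}^{e-1}f(s)g(ds+i)$; for $d=-1$ this is the usual convolution, and $f^{(n)}(i)=\sum_{k_1+\cdots+k_n\equiv i\ (\mathrm{mod}\ e)}f(k_1)\cdots f(k_n)$ is the $n$-fold convolution power. For matrices, $A\overset{d}{\ast}B=\big[\sum_{s,t=0}^{e-1}a_{s,t}b_{ds+i,dt+j}\big]_{0\le i,j\le e-1}$, and $A^{(n)}=A\overset{ -1}{\ast}\cdots\overset{ -1}{\ast}A$ ($n$ factors; this composition is associative). -}

module Defs where

open import Level using (Level)
open import Data.Nat as ℕ using (ℕ; zero; suc; NonZero)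
open import Data.Nat.DivMod using (_%_; m%n<n)
open import Data.Fin using (Fin; toℕ; fromℕ<; _≟_)
open import Relation.Nullary using (yes; no)
open import Algebra.Bundles using (CommutativeRing)
import Algebra.Properties.CommutativeMonoid.Sum as SumProps

-- Arithmetic in ℤ/eℤ, represented by Fin e (canonical residues 0..e-1).
module ZMod (e : ℕ) .{{_ : NonZero e}} where

  mod : ℕ → Fin e
  mod m = fromℕ< (m%n<n m e)

  _⊕_ : Fin e → Fin e → Fin e
  i ⊕ j = mod (toℕ i ℕ.+ toℕ j)

  _⊖_ : Fin e → Fin e → Fin e
  i ⊖ j = mod (toℕ i ℕ.+ (e ℕ.∸ toℕ j))

  _⊗_ : Fin e → Fin e → Fin e
  d ⊗ s = mod (toℕ d ℕ.* toℕ s)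

  𝟘 : Fin e
  𝟘 = mod 0

  -𝟙 : Fin e
  -𝟙 = mod (e ℕ.∸ 1)

module Conv {c ℓ : Level} (R : CommutativeRing c ℓ) (e : ℕ) .{{_ : NonZero e}} where
  open CommutativeRing R
  open SumProps +-commutativeMonoid using (sum)
  open ZMod e

  Σ : (Fin e → Carrier) → Carrier
  Σ = sum

  conv : Fin e → (Fin e → Carrier) → (Fin e → Carrier) → Fin e → Carrier
  conv d f g i = Σ (λ s → f s * g ((d ⊗ s) ⊕ i))

  convM : Fin e → (Fin e → Fin e → Carrier) → (Fin e → Fin e → Carrier)
        → Fin e → Fin e → Carrier
  convM d A B i j = Σ (λ s → Σ (λ t → A s t * B ((d ⊗ s) ⊕ i) ((d ⊗ t) ⊕ j)))

  -- n-fold convolution power: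
  -- f^(n)(i) = Σ_{k_1+⋯+k_n ≡ i} f(k_1)⋯f(k_n), computed by peeling off k_1:
  -- f^(0) = δ_0 (empty tuple), f^(n+1)(i) = Σ_{k} f(k) f^(n)(i - k).
  convPow : ℕ → (Fin e → Carrier) → Fin e → Carrier
  convPow zero f i with i ≟ 𝟘
  ... | yes _ = 1#
  ... | no _ = 0#
  convPow (suc n) f i = Σ (λ k → f k * convPow n f (i ⊖ k))

  -- A^(n) = A *_{-1} ⋯ *_{-1} A  (n factors); A^(1) = A, A^(n+1) = A *_{-1} A^(n).
  -- (n = 0 is never used in the statement.)
  convPowM : ℕ → (Fin e → Fin e → Carrier) → Fin e → Fin e → Carrier
  convPowM zero A i j = 0#
  convPowM (suc zero) A = A
  convPowM (suc (suc n)) A = convM -𝟙 A (convPowM (suc n) A)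

{-# OPTIONS --safe #-}
-- Write D s = d s. Expanding (f ∗_d g)(i) (f ∗_d g)(j) by the structure identities of f and g
-- gives a sum over (s, t, u, l) of A[t−s, u−s] f(u) B[D(t−s) + (j−i), l − (D s + i)] g(l);
-- the substitution k = l − D u, (a, b) = (t − s, u − s) turns the right-hand side
-- Σ_k (A ∗_d B)[j−i, k−i] (f ∗_d g)(k) into the same sum. Since f^(1) = f and
-- f^(n+1) = f ∗_{−1} f^(n), the statement for convolution powers follows by induction from d = −1.
module Submission where

open import Defs
open import Level using (Level)
open import Data.Nat using (ℕ; zero; suc; NonZero; _≤_)
open import Data.Fin using (Fin; toℕ; _≟_; punchIn)
open import Data.Fin.Properties using (toℕ<n; toℕ-fromℕ<; toℕ-injective; punchInᵢ≢i)
open import Data.Fin.Permutation using (permutation)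
open import Data.Product using (_×_; _,_)
open import Data.Empty using (⊥-elim)
open import Relation.Nullary using (¬_; yes; no)
open import Relation.Binary.PropositionalEquality as ≡ using (_≡_)
open import Algebra.Bundles using (CommutativeRing)
import Relation.Binary.Reasoning.Setoid as SetoidReasoning

module ResidueArithmetic (e : ℕ) .{{_ : NonZero e}} where
  open ZMod e
  open import Data.Nat using (_+_; _*_; _∸_; _%_)
  open import Data.Nat.Properties using (+-assoc; +-comm; +-identityʳ; m∸n+n≡m; m+[n∸m]≡n; <⇒≤; suc-pred)
  open import Data.Nat.DivMod
    using (m<n⇒m%n≡m; m%n%n≡m%n; %-congˡ; %-distribˡ-+; %-distribˡ-*; [m+n]%n≡m%n; [m+kn]%n≡m%n)
  open import Data.Nat.Solver using (module +-*-Solver)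
  open +-*-Solver

  infix 4 _isResidueOf_
  _isResidueOf_ : Fin e → ℕ → Set
  x isResidueOf m = toℕ x ≡ m % e

  toℕ-isResidue : ∀ x → x isResidueOf toℕ x
  toℕ-isResidue x = ≡.sym (m<n⇒m%n≡m (toℕ<n x))

  mod-isResidue : ∀ m → mod m isResidueOf m
  mod-isResidue m = toℕ-fromℕ< _

  ⊕-isResidue : ∀ {x y m n} → x isResidueOf m → y isResidueOf n → x ⊕ y isResidueOf m + n
  ⊕-isResidue {x} {y} {m} {n} p q = ≡.trans (mod-isResidue (toℕ x + toℕ y))
    (≡.trans (≡.cong₂ (λ a b → (a + b) % e) p q) (≡.sym (%-distribˡ-+ m n e)))

  ⊗-isResidue : ∀ {x y m n} → x isResidueOf m → y isResidueOf n → x ⊗ y isResidueOf m * n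
  ⊗-isResidue {x} {y} {m} {n} p q = ≡.trans (mod-isResidue (toℕ x * toℕ y))
    (≡.trans (≡.cong₂ (λ a b → (a * b) % e) p q) (≡.sym (%-distribˡ-* m n e)))

  ⊖-isResidue : ∀ {x m} y → x isResidueOf m → x ⊖ y isResidueOf m + (e ∸ toℕ y)
  ⊖-isResidue {x} {m} y p = begin
    toℕ (x ⊖ y)                        ≡⟨ mod-isResidue (toℕ x + c) ⟩
    (toℕ x + c) % e                    ≡⟨ %-congˡ (≡.cong (_+ c) p) ⟩
    (m % e + c) % e                    ≡⟨ %-distribˡ-+ (m % e) c e ⟩
    (m % e % e + c % e) % e            ≡⟨ %-congˡ (≡.cong (_+ c % e) (m%n%n≡m%n m e)) ⟩
    (m % e + c % e) % e                ≡⟨ %-distribˡ-+ m c e ⟨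
    (m + c) % e                        ∎
    where
    open ≡.≡-Reasoning
    c = e ∸ toℕ y

  ≡-byResidues : ∀ {x y m n} → x isResidueOf m → y isResidueOf n → m % e ≡ n % e → x ≡ y
  ≡-byResidues p q r = toℕ-injective (≡.trans p (≡.trans r (≡.sym q)))

  ⊕-comm : ∀ x y → x ⊕ y ≡ y ⊕ x
  ⊕-comm x y = ≡-byResidues (⊕-isResidue (toℕ-isResidue x) (toℕ-isResidue y))
    (⊕-isResidue (toℕ-isResidue y) (toℕ-isResidue x)) (%-congˡ (+-comm (toℕ x) (toℕ y)))

  ⊖-⊕-cancel : ∀ x y → (x ⊖ y) ⊕ y ≡ x
  ⊖-⊕-cancel x y = ≡-byResidues
    (⊕-isResidue (⊖-isResidue y (toℕ-isResidue x)) (toℕ-isResidue y)) (toℕ-isResidue x)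
    (≡.trans (%-congˡ (≡.trans (+-assoc (toℕ x) _ _) (≡.cong (toℕ x +_) (m∸n+n≡m (<⇒≤ (toℕ<n y))))))
             ([m+n]%n≡m%n (toℕ x) e))

  ⊕-⊖-cancel : ∀ x y → (x ⊕ y) ⊖ y ≡ x
  ⊕-⊖-cancel x y = ≡-byResidues
    (⊖-isResidue y (⊕-isResidue (toℕ-isResidue x) (toℕ-isResidue y))) (toℕ-isResidue x)
    (≡.trans (%-congˡ (≡.trans (+-assoc (toℕ x) _ _) (≡.cong (toℕ x +_) (m+[n∸m]≡n (<⇒≤ (toℕ<n y))))))
             ([m+n]%n≡m%n (toℕ x) e))

  x⊕y≡z⇒x≡z⊖y : ∀ {x y z} → x ⊕ y ≡ z → x ≡ z ⊖ y
  x⊕y≡z⇒x≡z⊖y {x} {y} ≡.refl = ≡.sym (⊕-⊖-cancel x y)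

  x⊕[y⊖x]≡y : ∀ x y → x ⊕ (y ⊖ x) ≡ y
  x⊕[y⊖x]≡y x y = ≡.trans (⊕-comm x _) (⊖-⊕-cancel y x)

  x⊖[x⊖y]≡y : ∀ x y → x ⊖ (x ⊖ y) ≡ y
  x⊖[x⊖y]≡y x y = ≡.sym (x⊕y≡z⇒x≡z⊖y (x⊕[y⊖x]≡y y x))

  x⊖𝟘≡x : ∀ x → x ⊖ 𝟘 ≡ x
  x⊖𝟘≡x x = ≡.sym (x⊕y≡z⇒x≡z⊖y (≡-byResidues
    (⊕-isResidue (toℕ-isResidue x) (mod-isResidue 0)) (toℕ-isResidue x)
    (%-congˡ (+-identityʳ (toℕ x)))))

  [dt⊕j]⊖[ds⊕i]≡d[t⊖s]⊕[j⊖i] : ∀ d s t i j →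
    ((d ⊗ t) ⊕ j) ⊖ ((d ⊗ s) ⊕ i) ≡ (d ⊗ (t ⊖ s)) ⊕ (j ⊖ i)
  [dt⊕j]⊖[ds⊕i]≡d[t⊖s]⊕[j⊖i] d s t i j = ≡.sym (x⊕y≡z⇒x≡z⊖y (≡.trans distribute
    (≡.cong₂ (λ a b → (d ⊗ a) ⊕ b) (⊖-⊕-cancel t s) (⊖-⊕-cancel j i))))
    where
    t′ = t ⊖ s
    j′ = j ⊖ i
    r = toℕ-isResidue
    distribute : ((d ⊗ t′) ⊕ j′) ⊕ ((d ⊗ s) ⊕ i) ≡ (d ⊗ (t′ ⊕ s)) ⊕ (j′ ⊕ i)
    distribute = ≡-byResidues
      (⊕-isResidue (⊕-isResidue (⊗-isResidue (r d) (r t′)) (r j′)) (⊕-isResidue (⊗-isResidue (r d) (r s)) (r i)))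
      (⊕-isResidue (⊗-isResidue (r d) (⊕-isResidue (r t′) (r s))) (⊕-isResidue (r j′) (r i)))
      (%-congˡ (solve 5 (λ D T J S I → (D :* T :+ J) :+ (D :* S :+ I) := D :* (T :+ S) :+ (J :+ I))
        ≡.refl (toℕ d) (toℕ t′) (toℕ j′) (toℕ s) (toℕ i)))

  -- ((-𝟙 ⊗ y) ⊕ x) ⊕ y represents (e ∸ 1) y + x + y = x + y e.
  x⊖y≡-𝟙y⊕x : ∀ x y → x ⊖ y ≡ (-𝟙 ⊗ y) ⊕ x
  x⊖y≡-𝟙y⊕x x y = ≡.sym (x⊕y≡z⇒x≡z⊖y (≡-byResidues
    (⊕-isResidue (⊕-isResidue (⊗-isResidue (mod-isResidue (e ∸ 1)) (r y)) (r x)) (r y)) (r x)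
    (≡.trans (%-congˡ (solve 3 (λ P Y X → P :* Y :+ X :+ Y := X :+ Y :* (con 1 :+ P)) ≡.refl (e ∸ 1) (toℕ y) (toℕ x)))
    (≡.trans (%-congˡ (≡.cong (λ z → toℕ x + toℕ y * z) (suc-pred e)))
             ([m+kn]%n≡m%n (toℕ x) (toℕ y) e)))))
    where
    r = toℕ-isResidue

module ConvolutionStructure {c ℓ : Level} (R : CommutativeRing c ℓ) (e : ℕ) .{{_ : NonZero e}} where
  open CommutativeRing R
  open ZMod e
  open Conv R e
  open ResidueArithmetic e
  open import Algebra.Properties.Semiring.Sum semiring
    using (sum; sum-cong-≋; *-distribˡ-sum; *-distribʳ-sum; ∑-comm; ∑-permute; sum-remove; sum-replicate-zero)
  open import Algebra.Properties.CommutativeSemigroup *-commutativeSemigroup using (interchange)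
  open SetoidReasoning setoid

  Σ-cong : ∀ {φ ψ : Fin e → Carrier} → (∀ x → φ x ≈ ψ x) → Σ φ ≈ Σ ψ
  Σ-cong = sum-cong-≋

  Σ-*-Σ : ∀ (φ ψ : Fin e → Carrier) → Σ φ * Σ ψ ≈ Σ (λ k → Σ (λ l → φ k * ψ l))
  Σ-*-Σ φ ψ = trans (*-distribʳ-sum (Σ ψ) φ) (Σ-cong (λ k → *-distribˡ-sum (φ k) ψ))

  Σ-translate : ∀ a (φ : Fin e → Carrier) → Σ φ ≈ Σ (λ x → φ (x ⊖ a))
  Σ-translate a φ = ∑-permute φ
    (permutation (_⊖ a) (_⊕ a) (λ x → ⊕-⊖-cancel x a) (λ x → ⊖-⊕-cancel x a))

  Σ-reflect : ∀ a (φ : Fin e → Carrier) → Σ φ ≈ Σ (λ x → φ (a ⊖ x))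
  Σ-reflect a φ = ∑-permute φ (permutation (a ⊖_) (a ⊖_) (x⊖[x⊖y]≡y a) (x⊖[x⊖y]≡y a))

  Σ²-reindex : ∀ u (X : Fin e → Fin e → Carrier) →
    Σ (λ s → Σ (λ t → X s t)) ≈ Σ (λ s → Σ (λ t → X (t ⊖ s) (u ⊖ s)))
  Σ²-reindex u X = begin
    Σ (λ s → Σ (λ t → X s t))             ≈⟨ ∑-comm X ⟩
    Σ (λ t → Σ (λ s → X s t))             ≈⟨ Σ-reflect u _ ⟩
    Σ (λ s → Σ (λ t → X t (u ⊖ s)))       ≈⟨ Σ-cong (λ s → Σ-translate s _) ⟩
    Σ (λ s → Σ (λ t → X (t ⊖ s) (u ⊖ s))) ∎

  Σ²-swap : ∀ (X : Fin e → Fin e → Fin e → Fin e → Carrier) →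
    Σ (λ a → Σ λ b → Σ λ c → Σ λ d → X a b c d) ≈ Σ (λ c → Σ λ d → Σ λ a → Σ λ b → X a b c d)
  Σ²-swap X = begin
    Σ (λ a → Σ λ b → Σ λ c → Σ λ d → X a b c d) ≈⟨ Σ-cong (λ a → ∑-comm λ b c → Σ λ d → X a b c d) ⟩
    Σ (λ a → Σ λ c → Σ λ b → Σ λ d → X a b c d) ≈⟨ ∑-comm (λ a c → Σ λ b → Σ λ d → X a b c d) ⟩
    Σ (λ c → Σ λ a → Σ λ b → Σ λ d → X a b c d) ≈⟨ Σ-cong (λ c → Σ-cong λ a → ∑-comm λ b d → X a b c d) ⟩
    Σ (λ c → Σ λ a → Σ λ d → Σ λ b → X a b c d) ≈⟨ Σ-cong (λ c → ∑-comm λ a d → Σ λ b → X a b c d) ⟩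
    Σ (λ c → Σ λ d → Σ λ a → Σ λ b → X a b c d) ∎

  sum-concentrated : ∀ {n} (φ : Fin n → Carrier) z → (∀ x → ¬ x ≡ z → φ x ≈ 0#) → sum φ ≈ φ z
  sum-concentrated {suc n} φ z φ≈0 = begin
    sum φ                                   ≈⟨ sum-remove {i = z} φ ⟩
    φ z + sum (λ x → φ (punchIn z x))       ≈⟨ +-congˡ (sum-cong-≋ (λ x → φ≈0 (punchIn z x) (punchInᵢ≢i z x))) ⟩
    φ z + sum {n} (λ _ → 0#)                ≈⟨ +-congˡ (sum-replicate-zero n) ⟩
    φ z + 0#                                ≈⟨ +-identityʳ _ ⟩
    φ z                                     ∎

  HasStructureMatrix : (Fin e → Carrier) → (Fin e → Fin e → Carrier) → Set ℓ
  HasStructureMatrix h M = ∀ i j → h i * h j ≈ Σ (λ k → M (j ⊖ i) (k ⊖ i) * h k)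

  HasStructureMatrix-cong : ∀ {h h′} M → (∀ x → h x ≈ h′ x) →
    HasStructureMatrix h′ M → HasStructureMatrix h M
  HasStructureMatrix-cong M h≈h′ hasM i j = trans (*-cong (h≈h′ i) (h≈h′ j))
    (trans (hasM i j) (Σ-cong (λ k → *-congˡ (sym (h≈h′ k)))))

  conv-structure : ∀ d {f g} A B → HasStructureMatrix f A → HasStructureMatrix g B →
    HasStructureMatrix (conv d f g) (convM d A B)
  conv-structure d {f} {g} A B hasA hasB i j = begin
    conv d f g i * conv d f g j                  ≈⟨ product-expansion ⟩
    Σ (λ s → Σ λ t → Σ λ u → Σ λ l → T s t u l)  ≈⟨ Σ²-swap T ⟩
    Σ (λ u → Σ λ l → Σ λ s → Σ λ t → T s t u l)  ≈⟨ structure-expansion ⟨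
    Σ (λ k → convM d A B (j ⊖ i) (k ⊖ i) * conv d f g k) ∎
    where
    D : Fin e → Fin e
    D = d ⊗_

    T : Fin e → Fin e → Fin e → Fin e → Carrier
    T s t u l = (A (t ⊖ s) (u ⊖ s) * f u) * (B (D (t ⊖ s) ⊕ (j ⊖ i)) (l ⊖ (D s ⊕ i)) * g l)

    hasB′ : ∀ s t → g (D s ⊕ i) * g (D t ⊕ j)
      ≈ Σ (λ l → B (D (t ⊖ s) ⊕ (j ⊖ i)) (l ⊖ (D s ⊕ i)) * g l)
    hasB′ s t = ≡.subst (λ x → g (D s ⊕ i) * g (D t ⊕ j) ≈ Σ (λ l → B x (l ⊖ (D s ⊕ i)) * g l))
      ([dt⊕j]⊖[ds⊕i]≡d[t⊖s]⊕[j⊖i] d s t i j) (hasB (D s ⊕ i) (D t ⊕ j))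

    product-expansion : conv d f g i * conv d f g j ≈ Σ (λ s → Σ λ t → Σ λ u → Σ λ l → T s t u l)
    product-expansion = begin
      conv d f g i * conv d f g j
        ≈⟨ Σ-*-Σ _ _ ⟩
      Σ (λ s → Σ λ t → (f s * g (D s ⊕ i)) * (f t * g (D t ⊕ j)))
        ≈⟨ Σ-cong (λ s → Σ-cong λ t → interchange _ _ _ _) ⟩
      Σ (λ s → Σ λ t → (f s * f t) * (g (D s ⊕ i) * g (D t ⊕ j)))
        ≈⟨ Σ-cong (λ s → Σ-cong λ t → *-cong (hasA s t) (hasB′ s t)) ⟩
      Σ (λ s → Σ λ t → Σ (λ u → A (t ⊖ s) (u ⊖ s) * f u)
                     * Σ (λ l → B (D (t ⊖ s) ⊕ (j ⊖ i)) (l ⊖ (D s ⊕ i)) * g l))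
        ≈⟨ Σ-cong (λ s → Σ-cong λ t → Σ-*-Σ _ _) ⟩
      Σ (λ s → Σ λ t → Σ λ u → Σ λ l → T s t u l) ∎

    structure-expansion : Σ (λ k → convM d A B (j ⊖ i) (k ⊖ i) * conv d f g k)
      ≈ Σ (λ u → Σ λ l → Σ λ s → Σ λ t → T s t u l)
    structure-expansion = begin
      Σ (λ k → convM d A B (j ⊖ i) (k ⊖ i) * conv d f g k)
        ≈⟨ Σ-cong (λ k → *-comm _ _) ⟩
      Σ (λ k → conv d f g k * convM d A B (j ⊖ i) (k ⊖ i))
        ≈⟨ Σ-cong (λ k → trans (Σ-*-Σ _ _) (Σ-cong λ u → Σ-cong λ a →
             *-distribˡ-sum (f u * g (D u ⊕ k)) (λ b → A a b * B (D a ⊕ (j ⊖ i)) (D b ⊕ (k ⊖ i))))) ⟩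
      Σ (λ k → Σ λ u → Σ λ a → Σ λ b → term k u a b)
        ≈⟨ ∑-comm (λ k u → Σ λ a → Σ λ b → term k u a b) ⟩
      Σ (λ u → Σ λ k → Σ λ a → Σ λ b → term k u a b)
        ≈⟨ Σ-cong (λ u → Σ-translate (D u) _) ⟩
      Σ (λ u → Σ λ l → Σ λ a → Σ λ b → term (l ⊖ D u) u a b)
        ≈⟨ Σ-cong (λ u → Σ-cong λ l → Σ²-reindex u _) ⟩
      Σ (λ u → Σ λ l → Σ λ s → Σ λ t → term (l ⊖ D u) u (t ⊖ s) (u ⊖ s))
        ≈⟨ Σ-cong (λ u → Σ-cong λ l → Σ-cong λ s → Σ-cong λ t → term≈T u l s t) ⟩
      Σ (λ u → Σ λ l → Σ λ s → Σ λ t → T s t u l) ∎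
      where
      term : Fin e → Fin e → Fin e → Fin e → Carrier
      term k u a b = (f u * g (D u ⊕ k)) * (A a b * B (D a ⊕ (j ⊖ i)) (D b ⊕ (k ⊖ i)))

      term≈T : ∀ u l s t → term (l ⊖ D u) u (t ⊖ s) (u ⊖ s) ≈ T s t u l
      term≈T u l s t = begin
        term (l ⊖ D u) u (t ⊖ s) (u ⊖ s)
          ≡⟨ ≡.cong₂ (λ x y → (f u * g x) * (A (t ⊖ s) (u ⊖ s) * B (D (t ⊖ s) ⊕ (j ⊖ i)) y))
               Du⊕[l⊖Du]≡l
               (≡.trans (≡.sym ([dt⊕j]⊖[ds⊕i]≡d[t⊖s]⊕[j⊖i] d s u i (l ⊖ D u)))
                        (≡.cong (_⊖ (D s ⊕ i)) Du⊕[l⊖Du]≡l)) ⟩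
        (f u * g l) * (A (t ⊖ s) (u ⊖ s) * B (D (t ⊖ s) ⊕ (j ⊖ i)) (l ⊖ (D s ⊕ i)))
          ≈⟨ trans (*-comm _ _) (interchange _ _ _ _) ⟩
        T s t u l ∎
        where
        Du⊕[l⊖Du]≡l : D u ⊕ (l ⊖ D u) ≡ l
        Du⊕[l⊖Du]≡l = x⊕[y⊖x]≡y (D u) l

  module _ (f : Fin e → Carrier) where

    convPow-zero-𝟘 : convPow 0 f 𝟘 ≈ 1#
    convPow-zero-𝟘 with 𝟘 ≟ 𝟘
    ... | yes _ = refl
    ... | no 𝟘≢𝟘 = ⊥-elim (𝟘≢𝟘 ≡.refl)

    convPow-zero-≢𝟘 : ∀ x → ¬ x ≡ 𝟘 → convPow 0 f x ≈ 0#
    convPow-zero-≢𝟘 x x≢𝟘 with x ≟ 𝟘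
    ... | yes x≡𝟘 = ⊥-elim (x≢𝟘 x≡𝟘)
    ... | no _ = refl

    convPow-one : ∀ i → convPow 1 f i ≈ f i
    convPow-one i = begin
      Σ (λ k → f k * convPow 0 f (i ⊖ k))
        ≈⟨ Σ-reflect i _ ⟩
      Σ (λ k → f (i ⊖ k) * convPow 0 f (i ⊖ (i ⊖ k)))
        ≈⟨ Σ-cong (λ k → *-congˡ (reflexive (≡.cong (convPow 0 f) (x⊖[x⊖y]≡y i k)))) ⟩
      Σ (λ k → f (i ⊖ k) * convPow 0 f k)
        ≈⟨ sum-concentrated _ 𝟘 (λ k k≢𝟘 → trans (*-congˡ (convPow-zero-≢𝟘 k k≢𝟘)) (zeroʳ _)) ⟩
      f (i ⊖ 𝟘) * convPow 0 f 𝟘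
        ≈⟨ *-cong (reflexive (≡.cong f (x⊖𝟘≡x i))) convPow-zero-𝟘 ⟩
      f i * 1#
        ≈⟨ *-identityʳ _ ⟩
      f i ∎

    convPow-suc : ∀ n i → convPow (suc n) f i ≈ conv -𝟙 f (convPow n f) i
    convPow-suc n i = Σ-cong (λ k → *-congˡ (reflexive (≡.cong (convPow n f) (x⊖y≡-𝟙y⊕x i k))))

    convPow-structure : ∀ A → HasStructureMatrix f A →
      ∀ n → HasStructureMatrix (convPow (suc n) f) (convPowM (suc n) A)
    convPow-structure A hasA zero = HasStructureMatrix-cong A convPow-one hasA
    convPow-structure A hasA (suc n) = HasStructureMatrix-cong (convPowM (suc (suc n)) A)
      (convPow-suc (suc n)) (conv-structure -𝟙 A (convPowM (suc n) A) hasA (convPow-structure A hasA n))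

proposition3p5 : ∀ {c ℓ k : Level} (R : CommutativeRing c ℓ)
    → let open CommutativeRing R in
      (K : Carrier → Set k)
    → (e : ℕ) .{{_ : NonZero e}} → 2 ≤ e
    → let open ZMod e in
      let open Conv R e in
      (f g : Fin e → Carrier) (A B : Fin e → Fin e → Carrier)
    → (∀ i j → K (A i j)) → (∀ i j → K (B i j))
    → (∀ i j → f i * f j ≈ Σ (λ k → A (j ⊖ i) (k ⊖ i) * f k))
    → (∀ i j → g i * g j ≈ Σ (λ k → B (j ⊖ i) (k ⊖ i) * g k))
    → (∀ (d : Fin e) → ¬ (d ≡ 𝟘) → ∀ i j →
         conv d f g i * conv d f g j
           ≈ Σ (λ k → convM d A B (j ⊖ i) (k ⊖ i) * conv d f g k))
      × (∀ (n : ℕ) → 1 ≤ n → ∀ i j →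
         convPow n f i * convPow n f j
           ≈ Σ (λ k → convPowM n A (j ⊖ i) (k ⊖ i) * convPow n f k))
proposition3p5 R _ e _ f g A B _ _ hasA hasB =
  (λ d _ → conv-structure d A B hasA hasB) ,
  λ { (suc n) _ → convPow-structure f A hasA n }
  where open ConvolutionStructure R e
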